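{- Let $G=(V,E,w)$ be a graph with non-negative node weights and let $\vec y$ be a fractional $w$-matching of $G$ with slacks $s(v)$. Let $X\subseteq\{v\in V: s(v)>0\}$ and $F\subseteq\{e\in E: y_e>0\}$. Define $y'_e:=0$ if $e\in F$ and $y'_e:=y_e$ otherwise, and $w'(v):=w(v)-s(v)-y(E(v)\cap F)$ if $v\in X$ and $w'(v):=w(v)-y(E(v)\cap F)$ if $v\notin X$. Then every augmenting path of $G$ with respect to the weight function $w'$ and the fractional $w'$-matching $\vec y'$ is also an augmenting path with respect to $w$ and $\vec y$.
   Context: A fractional $w$-matching is an assignment $y_e\ge0$ to edges with $\sum_{e\in E(v)}y_e\le w(v)$ for every node $v$, where $E(v)$ is the set of edges incident to $v$; $y(F'):=\sum_{e\in F'}y_e$. The slack of $v$ (w.r.t. weights $w$ and $\vec y$) is $s(v)=w(v)-\sum_{e\in E(v)}y_e$. An augmenting path w.r.t. weights $w$ and $\vec y$ is an odd-length path $(v_0,\dots,v_{2\ell+1})$ whose end nodes have positive slack and whose even edges $\{v_{2i-1},v_{2i}\}$, $i\in\{1,\dots,\ell\}$, have positive $y$-value.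
   Formalization: The node weights $w$ and the values $y_e$ of the fractional $w$-matching are taken to be rational. -}

module Defs where

open import Data.Nat using (ℕ; zero; suc; _*_) renaming (_+_ to _+ℕ_)
open import Data.Fin using (Fin; zero; suc; toℕ; inject₁; fromℕ; _≟_)
open import Data.Fin.Subset using (Subset; _∈_)
open import Data.Fin.Subset.Properties using (_∈?_)
open import Data.Bool using (Bool; true; false; if_then_else_; _∨_; _∧_)
open import Data.Product using (Σ; ∃; _×_; _,_; proj₁; proj₂)
open import Data.Sum using (_⊎_)
open import Relation.Nullary.Decidable using (⌊_⌋)
open import Relation.Binary.PropositionalEquality using (_≡_; _≢_)
open import Function.Definitions using (Injective)
open import Data.Rational using (ℚ; 0ℚ; _+_; _-_; _≤_; _<_)

record Graph : Set where
  field
    n    : ℕ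
    m    : ℕ
    ends : Fin m → Fin n × Fin n
    loopless : ∀ e → proj₁ (ends e) ≢ proj₂ (ends e)
    simple   : ∀ e f → (proj₁ (ends e) ≡ proj₁ (ends f) × proj₂ (ends e) ≡ proj₂ (ends f))
                     ⊎ (proj₁ (ends e) ≡ proj₂ (ends f) × proj₂ (ends e) ≡ proj₁ (ends f))
                     → e ≡ f

open Graph public

Node : Graph → Set
Node G = Fin (n G)

Edge : Graph → Set
Edge G = Fin (m G)

sumFin : ∀ {k} → (Fin k → ℚ) → ℚ
sumFin {zero}  f = 0ℚ
sumFin {suc k} f = f zero + sumFin (λ i → f (suc i))

incident : (G : Graph) → Node G → Edge G → Bool
incident G v e = ⌊ v ≟ proj₁ (ends G e) ⌋ ∨ ⌊ v ≟ proj₂ (ends G e) ⌋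

yAt : (G : Graph) → (Edge G → ℚ) → Node G → ℚ
yAt G y v = sumFin (λ e → if incident G v e then y e else 0ℚ)

yAtIn : (G : Graph) → (Edge G → ℚ) → Subset (m G) → Node G → ℚ
yAtIn G y F v = sumFin (λ e → if incident G v e ∧ ⌊ e ∈? F ⌋ then y e else 0ℚ)

IsFracMatching : (G : Graph) → (Node G → ℚ) → (Edge G → ℚ) → Set
IsFracMatching G w y = (∀ e → 0ℚ ≤ y e) × (∀ v → yAt G y v ≤ w v)

slack : (G : Graph) → (Node G → ℚ) → (Edge G → ℚ) → Node G → ℚ
slack G w y v = w v - yAt G y v

record Path (G : Graph) : Set where
  field
    len   : ℕ
    node  : Fin (suc len) → Node G
    edge  : Fin len → Edge G
    links : ∀ i → ends G (edge i) ≡ (node (inject₁ i) , node (suc i))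
                ⊎ ends G (edge i) ≡ (node (suc i) , node (inject₁ i))
    distinct : Injective _≡_ _≡_ node

open Path public

-- Augmenting path w.r.t. w and y: odd length 2l+1, end nodes with positive
-- slack, and the edges {v_{2i-1}, v_{2i}} (0-based edge indices 1,3,...,2l-1,
-- i.e. the odd indices) have positive y-value.
IsAugmenting : (G : Graph) → (Node G → ℚ) → (Edge G → ℚ) → Path G → Set
IsAugmenting G w y p =
  (∃ λ l → len p ≡ 2 * l +ℕ 1)
  × 0ℚ < slack G w y (node p zero)
  × 0ℚ < slack G w y (node p (fromℕ (len p)))
  × (∀ (i : Fin (len p)) → (∃ λ j → toℕ i ≡ 2 * j +ℕ 1) → 0ℚ < y (edge p i))

yPrime : (G : Graph) → (Edge G → ℚ) → Subset (m G) → Edge G → ℚ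
yPrime G y F e = if ⌊ e ∈? F ⌋ then 0ℚ else y e

wPrime : (G : Graph) → (Node G → ℚ) → (Edge G → ℚ) → Subset (n G) → Subset (m G) → Node G → ℚ
wPrime G w y X F v =
  if ⌊ v ∈? X ⌋ then w v - slack G w y v - yAtIn G y F v
               else w v - yAtIn G y F v

{-# OPTIONS --safe #-}
module Submission where

-- Off X, removing the edges of F from y lowers y(E(v)) by exactly y(E(v) ∩ F), which is
-- also what w' subtracts from w, so the slack is unchanged; on X the slack is positive by
-- hypothesis. An edge with y'_e > 0 is not in F, so y_e = y'_e > 0.

open import Defs
open import Data.Bool using (Bool; true; false; if_then_else_; _∧_)
open import Data.Fin using (Fin; zero; suc)
open import Data.Fin.Subset using (Subset; _∈_; _∉_)
open import Data.Fin.Subset.Properties using (_∈?_)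
open import Data.Product using (_,_)
open import Data.Rational using (ℚ; 0ℚ; _≤_; _<_; _+_; _-_; -_)
open import Data.Rational.Properties
  using (+-assoc; +-identityˡ; +-identityʳ; neg-distrib-+; <-irrefl; +-0-commutativeMonoid)
open import Data.Empty using (⊥-elim)
import Data.Nat as ℕ
open import Function using (case_of_)
open import Relation.Nullary using (yes; no; contradiction)
open import Relation.Nullary.Decidable using (⌊_⌋)
open import Relation.Binary.PropositionalEquality using (_≡_; refl; sym; cong; cong₂; subst; module ≡-Reasoning)
open import Algebra.Bundles using (CommutativeMonoid)
open import Algebra.Properties.CommutativeSemigroup
  (CommutativeMonoid.commutativeSemigroup +-0-commutativeMonoid) using (interchange)

sumFin-cong : ∀ {k} {f g : Fin k → ℚ} → (∀ i → f i ≡ g i) → sumFin f ≡ sumFin g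
sumFin-cong {ℕ.zero}  f≗g = refl
sumFin-cong {ℕ.suc k} f≗g = cong₂ _+_ (f≗g zero) (sumFin-cong (λ i → f≗g (suc i)))

sumFin-+ : ∀ {k} (f g : Fin k → ℚ) → sumFin f + sumFin g ≡ sumFin (λ i → f i + g i)
sumFin-+ {ℕ.zero}  f g = +-identityˡ 0ℚ
sumFin-+ {ℕ.suc k} f g = begin
  (f zero + sumFin (λ i → f (suc i))) + (g zero + sumFin (λ i → g (suc i)))
    ≡⟨ interchange (f zero) _ (g zero) _ ⟩
  (f zero + g zero) + (sumFin (λ i → f (suc i)) + sumFin (λ i → g (suc i)))
    ≡⟨ cong (f zero + g zero +_) (sumFin-+ (λ i → f (suc i)) (λ i → g (suc i))) ⟩
  (f zero + g zero) + sumFin (λ i → f (suc i) + g (suc i))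
    ∎
  where open ≡-Reasoning

if-∧-+-if-if : ∀ (a b : Bool) (x : ℚ) →
  (if a ∧ b then x else 0ℚ) + (if a then (if b then 0ℚ else x) else 0ℚ) ≡ (if a then x else 0ℚ)
if-∧-+-if-if false b     x = +-identityˡ 0ℚ
if-∧-+-if-if true  true  x = +-identityʳ x
if-∧-+-if-if true  false x = +-identityˡ x

yAtIn+yAt-yPrime≡yAt : (G : Graph) (y : Edge G → ℚ) (F : Subset (m G)) (v : Node G) →
  yAtIn G y F v + yAt G (yPrime G y F) v ≡ yAt G y v
yAtIn+yAt-yPrime≡yAt G y F v = begin
  yAtIn G y F v + yAt G (yPrime G y F) v
    ≡⟨ sumFin-+ (λ e → if incident G v e ∧ ⌊ e ∈? F ⌋ then y e else 0ℚ)
                (λ e → if incident G v e then yPrime G y F e else 0ℚ) ⟩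
  sumFin (λ e → (if incident G v e ∧ ⌊ e ∈? F ⌋ then y e else 0ℚ)
              + (if incident G v e then yPrime G y F e else 0ℚ))
    ≡⟨ sumFin-cong (λ e → if-∧-+-if-if (incident G v e) ⌊ e ∈? F ⌋ (y e)) ⟩
  yAt G y v
    ∎
  where open ≡-Reasoning

slack-wPrime-yPrime-∉ : (G : Graph) (w : Node G → ℚ) (y : Edge G → ℚ)
  (X : Subset (n G)) (F : Subset (m G)) (v : Node G) → v ∉ X →
  slack G (wPrime G w y X F) (yPrime G y F) v ≡ slack G w y v
slack-wPrime-yPrime-∉ G w y X F v v∉X with v ∈? X
... | yes v∈X = contradiction v∈X v∉X
... | no  _   = begin
  (w v - yAtIn G y F v) - yAt G (yPrime G y F) v
    ≡⟨ +-assoc (w v) _ _ ⟩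
  w v + ((- yAtIn G y F v) - yAt G (yPrime G y F) v)
    ≡⟨ cong (w v +_) (sym (neg-distrib-+ (yAtIn G y F v) (yAt G (yPrime G y F) v))) ⟩
  w v - (yAtIn G y F v + yAt G (yPrime G y F) v)
    ≡⟨ cong (_-_ (w v)) (yAtIn+yAt-yPrime≡yAt G y F v) ⟩
  w v - yAt G y v
    ∎
  where open ≡-Reasoning

slack-wPrime-yPrime-pos⇒slack-pos : (G : Graph) (w : Node G → ℚ) (y : Edge G → ℚ)
  (X : Subset (n G)) → (∀ v → v ∈ X → 0ℚ < slack G w y v) → (F : Subset (m G)) (v : Node G) →
  0ℚ < slack G (wPrime G w y X F) (yPrime G y F) v → 0ℚ < slack G w y v
slack-wPrime-yPrime-pos⇒slack-pos G w y X X-slack F v s′>0 = case v ∈? X of λ where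
  (yes v∈X) → X-slack v v∈X
  (no  v∉X) → subst (0ℚ <_) (slack-wPrime-yPrime-∉ G w y X F v v∉X) s′>0

yPrime-pos⇒pos : (G : Graph) (y : Edge G → ℚ) (F : Subset (m G)) (e : Edge G) →
  0ℚ < yPrime G y F e → 0ℚ < y e
yPrime-pos⇒pos G y F e y′>0 with e ∈? F
... | yes _ = ⊥-elim (<-irrefl refl y′>0)
... | no  _ = y′>0

lemma3p3 : (G : Graph) (w : Node G → ℚ) (y : Edge G → ℚ)
           → (∀ v → 0ℚ ≤ w v)
           → IsFracMatching G w y
           → (X : Subset (n G)) → (∀ v → v ∈ X → 0ℚ < slack G w y v)
           → (F : Subset (m G)) → (∀ e → e ∈ F → 0ℚ < y e)
           → (p : Path G)
           → IsAugmenting G (wPrime G w y X F) (yPrime G y F) p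
           → IsAugmenting G w y p
lemma3p3 G w y _ _ X X-slack F _ p (odd , start , end , even-edges) =
  odd , endpoint start , endpoint end ,
  λ i i-odd → yPrime-pos⇒pos G y F (edge p i) (even-edges i i-odd)
  where
  endpoint : ∀ {v} → 0ℚ < slack G (wPrime G w y X F) (yPrime G y F) v → 0ℚ < slack G w y v
  endpoint = slack-wPrime-yPrime-pos⇒slack-pos G w y X X-slack F _
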